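{- For $n \ge 2$, let $\tau(P_2 \square P_n)$ denote the number of minimum dominating sets of $P_2 \square P_n$. Then $\tau(P_2 \square P_n) = 6$ if $n=2$; $3$ if $n=3$; $17$ if $n=6$; $2$ if $n$ is odd and $n \ne 3$; and $2n+4$ if $n$ is even and $n \ne 2, 6$.
   Context: $P_2 \square P_n$ is the Cartesian product of the path on 2 vertices with the path on $n$ vertices. A dominating set of a graph $G$ is a set $D\subseteq V(G)$ such that every vertex not in $D$ is adjacent to a vertex of $D$; a minimum dominating set ($\gamma(G)$-set) is a dominating set of minimum cardinality. $\tau(G)$ is the total number of $\gamma(G)$-sets. -}

module Defs where

open import Data.Nat using (ℕ; zero; suc; _≤_; _≤?_; _*_)
open import Data.Bool using (Bool; true; false; _∧_; _∨_; T)
open import Data.Fin using (Fin; zero; suc; toℕ; remQuot)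
open import Data.Fin.Subset using (Subset; _∈_; ∣_∣)
open import Data.Fin.Subset.Properties using (_∈?_; anySubset?)
open import Data.Vec using (Vec; []; _∷_)
open import Data.List using (List; []; _∷_; map; _++_; length; filter)
open import Data.List.Relation.Unary.All using (All)
open import Data.List.Relation.Unary.All.Properties using ()
import Data.List.Relation.Unary.All as All
open import Data.Product using (Σ; _×_; _,_)
open import Data.Sum using (_⊎_)
open import Relation.Nullary using (Dec; yes; no; ¬_)
open import Relation.Nullary.Decidable using (_×-dec_; _⊎-dec_; ¬?; decidable-stable)
open import Relation.Unary using (Decidable)
open import Relation.Binary.PropositionalEquality using (_≡_)
open import Data.Fin.Properties using (any?; all?)

record Graph : Set where
  field
    V   : ℕ
    adj : Fin V → Fin V → Bool
open Graph public

_~P_ : {n : ℕ} → Fin n → Fin n → Bool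
zero  ~P zero  = false
zero  ~P suc zero = true
zero  ~P suc (suc _) = false
suc _ ~P zero  = false  -- handled symmetrically below
suc i ~P suc j = i ~P j

pathAdj : {n : ℕ} → Fin n → Fin n → Bool
pathAdj i j = (i ~P j) ∨ (j ~P i)

eqF : {n : ℕ} → Fin n → Fin n → Bool
eqF zero zero = true
eqF zero (suc _) = false
eqF (suc _) zero = false
eqF (suc i) (suc j) = eqF i j

P2□P : ℕ → Graph
P2□P n = record
  { V   = 2 * n
  ; adj = λ x y → adjPair (remQuot n x) (remQuot n y)
  }
  where
  adjPair : Fin 2 × Fin n → Fin 2 × Fin n → Bool
  adjPair (a , b) (c , d) = (eqF a c ∧ pathAdj b d) ∨ (eqF b d ∧ pathAdj a c)

Dominating : (G : Graph) → Subset (V G) → Set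
Dominating G D = ∀ v → ¬ (v ∈ D) → Σ (Fin (V G)) λ u → u ∈ D × T (adj G u v)

IsGammaSet : (G : Graph) → Subset (V G) → Set
IsGammaSet G D = Dominating G D × (∀ D′ → Dominating G D′ → ∣ D ∣ ≤ ∣ D′ ∣)

allSubsets : (m : ℕ) → List (Subset m)
allSubsets zero    = [] ∷ []
allSubsets (suc m) = map (true ∷_) (allSubsets m) ++ map (false ∷_) (allSubsets m)

dominating? : (G : Graph) → Decidable (Dominating G)
dominating? G D = all? λ v → dec v
  where
  open import Relation.Nullary.Decidable using (map′)
  dec : ∀ v → Dec (¬ (v ∈ D) → Σ (Fin (V G)) λ u → u ∈ D × T (adj G u v))
  dec v with v ∈? D
  ... | yes v∈D = yes (λ v∉D → Data.Empty.⊥-elim (v∉D v∈D))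
    where import Data.Empty
  ... | no v∉D with any? (λ u → (u ∈? D) ×-dec Data.Bool.T? (adj G u v))
    where import Data.Bool
  ...   | yes p = yes (λ _ → p)
  ...   | no ¬p = no (λ f → ¬p (f v∉D))

isGamma? : (G : Graph) → Decidable (IsGammaSet G)
isGamma? G D with dominating? G D
... | no ¬d = no (λ { (d , _) → ¬d d })
... | yes d with anySubset? (λ D′ → dominating? G D′ ×-dec ¬? (∣ D ∣ ≤? ∣ D′ ∣))
...   | yes (D′ , d′ , ¬le) = no (λ { (_ , m) → ¬le (m D′ d′) })
...   | no ¬ex = yes (d , λ D′ d′ → decidable-stable (∣ D ∣ ≤? ∣ D′ ∣) (λ ¬le → ¬ex (D′ , d′ , ¬le)))

τ : Graph → ℕ
τ G = length (filter (isGamma? G) (allSubsets (V G)))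

module Submission where

-- A subset D of V(P₂□Pₙ) = Fin (2n) is a pair of rows x, y : Vec Bool n, D = x ++ y,
-- and |D| is the weight |x| + |y|.  The argument has four parts.
--  1. Counting: τ is a double sum, over all pairs of rows, of the indicator of being a γ-set.
--  2. Scanning: an automaton reads the columns (xᵢ, yᵢ) left to right, remembering the
--     last column and which of its two cells are already dominated; it accepts (x, y)
--     exactly when x ++ y is dominating.
--  3. Dynamic programming: dp n s is the minimum weight of an accepted continuation of
--     length n from state s together with the number of continuations attaining it.  Its
--     correctness (`dp-sound`) gives τ(P₂□Pₙ) = c whenever dp n start = (M , c) with c ≠ 0.
--  4. Periodicity: for n ≥ 9 the table dp n is 2-periodic up to an affine change.  Running
--     two steps of the recursion symbolically, on counts a·j + b, shows that at the start
--     state dp (9 + 2j) = (j + 5, 2) and dp (10 + 2j) = (j + 6, 4j + 24), whence τ = 2 and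
--     τ = 2n + 4 respectively; n = 2, …, 8 are evaluated directly.

open import Defs
open import Data.Nat using (ℕ; _≤_; _+_; _*_)
open import Data.Nat.Divisibility using (_∣_)
open import Relation.Nullary using (¬_)
open import Relation.Binary.PropositionalEquality using (_≡_; _≢_)
open import Data.Product using (_×_)

open import Function using (_∘_; _⇔_; mk⇔; Equivalence)
open import Data.Nat using (zero; suc; _<_; _<?_; _≡ᵇ_; z≤n; s≤s)
open import Data.Nat.Properties
open import Data.Nat.Divisibility using (divides; _∣?_; ∣1⇒≡1; ∣m+n∣m⇒∣n; n∣m*n)
open import Data.Nat.Tactic.RingSolver using (solve-∀)
open import Algebra.Properties.CommutativeSemigroup +-commutativeSemigroup using (interchange; x∙yz≈y∙xz)
open import Data.Bool using (Bool; true; false; _∧_; _∨_; T; if_then_else_)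
open import Data.Bool.Properties using (T-∧; T-∨; T-≡; ∧-zeroʳ; ∧-identityʳ; ∨-identityʳ)
open import Data.Empty using (⊥-elim)
open import Data.Unit using (⊤; tt)
open import Data.Product using (Σ; _,_; proj₁; proj₂; uncurry)
import Data.Product as Product
open import Data.Sum using (_⊎_; inj₁; inj₂)
open import Relation.Nullary using (Dec; yes; no; does)
open import Relation.Nullary.Decidable using (dec-true; dec-false; toWitnessFalse)
open import Relation.Binary.PropositionalEquality using (refl; sym; trans; cong; cong₂; subst; subst₂; module ≡-Reasoning)
open import Data.Fin using (Fin; zero; suc; remQuot; combine)
open import Data.Fin.Properties using (remQuot-combine; combine-remQuot)
open import Data.Fin.Subset using (Subset; _∈_; ∣_∣)
open import Data.Vec using (Vec; []; _∷_; _++_; lookup; splitAt)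
open import Data.Vec.Properties using (lookup-++ˡ; lookup-++ʳ; []=⇒lookup; lookup⇒[]=)
import Data.List as List
open List using (List; []; _∷_)

∑ : {A : Set} → List A → (A → ℕ) → ℕ
∑ []      f = 0
∑ (a ∷ l) f = f a + ∑ l f

∑-++ : {A : Set} (l m : List A) (f : A → ℕ) → ∑ (l List.++ m) f ≡ ∑ l f + ∑ m f
∑-++ []      m f = refl
∑-++ (a ∷ l) m f = trans (cong (f a +_) (∑-++ l m f)) (sym (+-assoc (f a) (∑ l f) (∑ m f)))

∑-map : {A B : Set} (g : A → B) (l : List A) (f : B → ℕ) → ∑ (List.map g l) f ≡ ∑ l (f ∘ g)
∑-map g []      f = refl
∑-map g (a ∷ l) f = cong (f (g a) +_) (∑-map g l f)

∑-cong : {A : Set} (l : List A) {f g : A → ℕ} → (∀ a → f a ≡ g a) → ∑ l f ≡ ∑ l g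
∑-cong []      f≗g = refl
∑-cong (a ∷ l) f≗g = cong₂ _+_ (f≗g a) (∑-cong l f≗g)

∑-+ : {A : Set} (l : List A) (f g : A → ℕ) → ∑ l (λ a → f a + g a) ≡ ∑ l f + ∑ l g
∑-+ []      f g = refl
∑-+ (a ∷ l) f g = trans (cong (f a + g a +_) (∑-+ l f g)) (interchange (f a) (g a) (∑ l f) (∑ l g))

∑-zero : {A : Set} (l : List A) {f : A → ℕ} → (∀ a → f a ≡ 0) → ∑ l f ≡ 0
∑-zero []      f≗0 = refl
∑-zero (a ∷ l) f≗0 = cong₂ _+_ (f≗0 a) (∑-zero l f≗0)

∑-nonzero : {A : Set} (l : List A) (f : A → ℕ) → ∑ l f ≢ 0 → Σ A λ a → f a ≢ 0
∑-nonzero []      f ∑≢0 = ⊥-elim (∑≢0 refl)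
∑-nonzero (a ∷ l) f ∑≢0 with f a in fa
... | zero  = ∑-nonzero l f ∑≢0
... | suc _ = a , λ fa≡0 → 0≢1+n (trans (sym fa≡0) fa)

𝟙 : Bool → ℕ
𝟙 true  = 1
𝟙 false = 0

𝟙≢0⇒T : ∀ b → 𝟙 b ≢ 0 → T b
𝟙≢0⇒T true  _   = tt
𝟙≢0⇒T false 𝟙≢0 = 𝟙≢0 refl

length-filter≡∑ : {A : Set} {P : A → Set} (P? : ∀ a → Dec (P a)) (l : List A) →
  List.length (List.filter P? l) ≡ ∑ l (𝟙 ∘ does ∘ P?)
length-filter≡∑ P? []      = refl
length-filter≡∑ P? (a ∷ l) with does (P? a)
... | true  = cong suc (length-filter≡∑ P? l)
... | false = length-filter≡∑ P? l

∑-subsets-suc : ∀ n (h : Subset (suc n) → ℕ) →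
  ∑ (allSubsets (suc n)) h ≡ ∑ (allSubsets n) (h ∘ (true ∷_)) + ∑ (allSubsets n) (h ∘ (false ∷_))
∑-subsets-suc n h =
  trans (∑-++ (List.map (true ∷_) (allSubsets n)) (List.map (false ∷_) (allSubsets n)) h)
        (cong₂ _+_ (∑-map (true ∷_) (allSubsets n) h) (∑-map (false ∷_) (allSubsets n) h))

∑-subsets-++ : ∀ a b (h : Subset (a + b) → ℕ) →
  ∑ (allSubsets (a + b)) h ≡ ∑ (allSubsets a) λ x → ∑ (allSubsets b) λ z → h (x ++ z)
∑-subsets-++ zero    b h = sym (+-identityʳ _)
∑-subsets-++ (suc a) b h = begin
  ∑ (allSubsets (suc a + b)) h
    ≡⟨ ∑-subsets-suc (a + b) h ⟩
  ∑ (allSubsets (a + b)) (h ∘ (true ∷_)) + ∑ (allSubsets (a + b)) (h ∘ (false ∷_))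
    ≡⟨ cong₂ _+_ (∑-subsets-++ a b (h ∘ (true ∷_))) (∑-subsets-++ a b (h ∘ (false ∷_))) ⟩
  ∑ (allSubsets a) (F ∘ (true ∷_)) + ∑ (allSubsets a) (F ∘ (false ∷_))
    ≡⟨ sym (∑-subsets-suc a F) ⟩
  ∑ (allSubsets (suc a)) F ∎
  where
  open ≡-Reasoning
  F : Subset (suc a) → ℕ
  F x = ∑ (allSubsets b) λ z → h (x ++ z)

#pairs : ∀ n → (Vec Bool n → Vec Bool n → Bool) → ℕ
#pairs n Q = ∑ (allSubsets n) λ x → ∑ (allSubsets n) λ y → 𝟙 (Q x y)

count-subsets : ∀ n (P : Subset (2 * n) → Bool) →
  ∑ (allSubsets (2 * n)) (𝟙 ∘ P) ≡ #pairs n (λ x y → P (x ++ (y ++ [])))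
count-subsets n P = trans (∑-subsets-++ n (n + 0) (𝟙 ∘ P)) (∑-cong (allSubsets n) drop-last)
  where
  drop-last : ∀ x → ∑ (allSubsets (n + 0)) (λ z → 𝟙 (P (x ++ z))) ≡ ∑ (allSubsets n) (λ y → 𝟙 (P (x ++ (y ++ []))))
  drop-last x = trans (∑-subsets-++ n 0 _) (∑-cong (allSubsets n) (λ y → +-identityʳ _))

#pairs-suc : ∀ n Q → #pairs (suc n) Q ≡
  (#pairs n (λ x y → Q (true ∷ x) (true ∷ y)) + #pairs n (λ x y → Q (true ∷ x) (false ∷ y)))
  + (#pairs n (λ x y → Q (false ∷ x) (true ∷ y)) + #pairs n (λ x y → Q (false ∷ x) (false ∷ y)))
#pairs-suc n Q = trans (∑-subsets-suc n _) (cong₂ _+_ (first true) (first false))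
  where
  first : ∀ a → ∑ (allSubsets n) (λ x → ∑ (allSubsets (suc n)) λ y → 𝟙 (Q (a ∷ x) y)) ≡
          #pairs n (λ x y → Q (a ∷ x) (true ∷ y)) + #pairs n (λ x y → Q (a ∷ x) (false ∷ y))
  first a = trans (∑-cong (allSubsets n) (λ x → ∑-subsets-suc n _)) (∑-+ (allSubsets n) _ _)

#pairs-cong : ∀ n {Q R : Vec Bool n → Vec Bool n → Bool} → (∀ x y → Q x y ≡ R x y) → #pairs n Q ≡ #pairs n R
#pairs-cong n Q≗R = ∑-cong (allSubsets n) λ x → ∑-cong (allSubsets n) λ y → cong 𝟙 (Q≗R x y)

#pairs-zero : ∀ n {Q : Vec Bool n → Vec Bool n → Bool} → (∀ x y → Q x y ≡ false) → #pairs n Q ≡ 0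
#pairs-zero n Q≗false = ∑-zero (allSubsets n) λ x → ∑-zero (allSubsets n) λ y → cong 𝟙 (Q≗false x y)

#pairs-witness : ∀ n Q → #pairs n Q ≢ 0 → Σ (Vec Bool n) λ x → Σ (Vec Bool n) λ y → T (Q x y)
#pairs-witness n Q #≢0 with ∑-nonzero (allSubsets n) _ #≢0
... | x , ∑≢0 with ∑-nonzero (allSubsets n) _ ∑≢0
...   | y , 𝟙≢0 = x , y , 𝟙≢0⇒T (Q x y) 𝟙≢0

∣∷∣ : ∀ {n} a (x : Vec Bool n) → ∣ a ∷ x ∣ ≡ 𝟙 a + ∣ x ∣
∣∷∣ true  x = refl
∣∷∣ false x = refl

∣++∣ : ∀ {m k} (x : Vec Bool m) (z : Vec Bool k) → ∣ x ++ z ∣ ≡ ∣ x ∣ + ∣ z ∣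
∣++∣ []      z = refl
∣++∣ (a ∷ x) z = begin
  ∣ a ∷ (x ++ z) ∣      ≡⟨ ∣∷∣ a (x ++ z) ⟩
  𝟙 a + ∣ x ++ z ∣      ≡⟨ cong (𝟙 a +_) (∣++∣ x z) ⟩
  𝟙 a + (∣ x ∣ + ∣ z ∣) ≡⟨ sym (+-assoc (𝟙 a) (∣ x ∣) (∣ z ∣)) ⟩
  (𝟙 a + ∣ x ∣) + ∣ z ∣ ≡⟨ cong (_+ ∣ z ∣) (sym (∣∷∣ a x)) ⟩
  ∣ a ∷ x ∣ + ∣ z ∣     ∎
  where open ≡-Reasoning

weight : ∀ {n} → Vec Bool n → Vec Bool n → ℕ
weight x y = ∣ x ∣ + ∣ y ∣

∣rows∣ : ∀ {n} (x y : Vec Bool n) → ∣ x ++ (y ++ []) ∣ ≡ weight x y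
∣rows∣ x y = trans (∣++∣ x (y ++ [])) (cong (∣ x ∣ +_) (trans (∣++∣ y []) (+-identityʳ (∣ y ∣))))

weight-∷ : ∀ {n} a b (x y : Vec Bool n) → weight (a ∷ x) (b ∷ y) ≡ (𝟙 a + 𝟙 b) + weight x y
weight-∷ a b x y = begin
  ∣ a ∷ x ∣ + ∣ b ∷ y ∣         ≡⟨ cong₂ _+_ (∣∷∣ a x) (∣∷∣ b y) ⟩
  (𝟙 a + ∣ x ∣) + (𝟙 b + ∣ y ∣) ≡⟨ interchange (𝟙 a) (∣ x ∣) (𝟙 b) (∣ y ∣) ⟩
  (𝟙 a + 𝟙 b) + weight x y      ∎
  where open ≡-Reasoning

rows : ∀ n (D : Subset (2 * n)) → Σ (Vec Bool n) λ x → Σ (Vec Bool n) λ y → D ≡ x ++ (y ++ [])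
rows n D with splitAt n D
... | x , z , D≡x++z with splitAt n z
...   | y , [] , z≡y++[] = x , y , trans D≡x++z (cong (x ++_) z≡y++[])

-- The state after reading a column: its two entries, and whether each of its two cells is
-- already dominated (by itself, by its partner in the column, or by the column before).
record Scan : Set where
  constructor scan
  field
    top bot topDom botDom : Bool

-- Column (a, b) may follow iff afterwards both cells of the previous column are dominated.
admits : Scan → Bool → Bool → Bool
admits (scan _ _ td bd) a b = (td ∨ a) ∧ (bd ∨ b)

-- The state after reading column (a, b): the previous column's entries now dominate it.
after : Scan → Bool → Bool → Scan
after (scan a₀ b₀ _ _) a b = scan a b (a₀ ∨ a ∨ b) (b₀ ∨ b ∨ a)

-- Read the columns (xᵢ, yᵢ) from state s; at the end the last column must be dominated.
accepts : ∀ {n} → Scan → Vec Bool n → Vec Bool n → Bool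
accepts (scan _ _ td bd) [] [] = td ∧ bd
accepts s (a ∷ x) (b ∷ y) = admits s a b ∧ accepts (after s a b) x y

-- Before the first column: an empty column whose cells need no domination.
start : Scan
start = scan false false true true

head? : ∀ {n} → Vec Bool n → Bool
head? []      = false
head? (a ∷ _) = a

-- covered p x y i: cell i of row x is dominated by the set with rows x and y, where p is
-- the entry just left of the first cell of x.
covered : ∀ {n} → Bool → Vec Bool n → Vec Bool n → Fin n → Bool
covered p (a ∷ x) (b ∷ y) zero    = (p ∨ a ∨ b) ∨ head? x
covered p (a ∷ x) (b ∷ y) (suc i) = covered a x y i

allCovered : ∀ {n} → Bool → Bool → Vec Bool n → Vec Bool n → Bool
allCovered p q []      []      = true
allCovered p q (a ∷ x) (b ∷ y) = (((p ∨ a ∨ b) ∨ head? x) ∧ ((q ∨ b ∨ a) ∨ head? y)) ∧ allCovered a b x y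

accepts-allCovered : ∀ {n} a b td bd (x y : Vec Bool n) →
  accepts (scan a b td bd) x y ≡ ((td ∨ head? x) ∧ (bd ∨ head? y)) ∧ allCovered a b x y
accepts-allCovered a b true  true  [] [] = refl
accepts-allCovered a b true  false [] [] = refl
accepts-allCovered a b false bd    [] [] = refl
accepts-allCovered a b td    bd    (a′ ∷ x) (b′ ∷ y) =
  cong (admits (scan a b td bd) a′ b′ ∧_) (accepts-allCovered a′ b′ (a ∨ a′ ∨ b′) (b ∨ b′ ∨ a′) x y)

allCovered⇔ : ∀ {n} p q (x y : Vec Bool n) →
  T (allCovered p q x y) ⇔ (∀ i → T (covered p x y i) × T (covered q y x i))
allCovered⇔ p q x y = mk⇔ (to p q x y) (from p q x y)
  where
  to : ∀ {n} p q (x y : Vec Bool n) → T (allCovered p q x y) → ∀ i → T (covered p x y i) × T (covered q y x i)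
  to p q (a ∷ x) (b ∷ y) h zero    = Equivalence.to T-∧ (proj₁ (Equivalence.to T-∧ h))
  to p q (a ∷ x) (b ∷ y) h (suc i) = to a b x y (proj₂ (Equivalence.to (T-∧ {((p ∨ a ∨ b) ∨ head? x) ∧ ((q ∨ b ∨ a) ∨ head? y)}) h)) i
  from : ∀ {n} p q (x y : Vec Bool n) → (∀ i → T (covered p x y i) × T (covered q y x i)) → T (allCovered p q x y)
  from p q []      []      cov = tt
  from p q (a ∷ x) (b ∷ y) cov =
    Equivalence.from T-∧ (Equivalence.from T-∧ (cov zero) , from a b x y (cov ∘ suc))

T-∨ˡ : ∀ {a} b → T a → T (a ∨ b)
T-∨ˡ {a} b t = Equivalence.from (T-∨ {a} {b}) (inj₁ t)

T-∨ʳ : ∀ a {b} → T b → T (a ∨ b)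
T-∨ʳ a {b} t = Equivalence.from (T-∨ {a} {b}) (inj₂ t)

RowNeighbour : ∀ {n} → Vec Bool n → Fin n → Set
RowNeighbour {n} x i = Σ (Fin n) λ j → T (pathAdj j i) × lookup x j ≡ true

-- A covered cell is in the set, has its partner in the set, or has a row neighbour in the
-- set; the entry p left of the row counts as a neighbour of the first cell.
covered-sound : ∀ {n} p (x y : Vec Bool n) i → T (covered p x y i) →
  lookup x i ≡ true ⊎ lookup y i ≡ true ⊎ RowNeighbour (p ∷ x) (suc i)
covered-sound p (a ∷ x) (b ∷ y) zero h with Equivalence.to (T-∨ {p ∨ a ∨ b}) h
... | inj₂ right with x
...   | c ∷ _ = inj₂ (inj₂ (suc (suc zero) , tt , Equivalence.to T-≡ right))
covered-sound p (a ∷ x) (b ∷ y) zero h | inj₁ pab with Equivalence.to (T-∨ {p}) pab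
... | inj₁ left = inj₂ (inj₂ (zero , tt , Equivalence.to T-≡ left))
... | inj₂ ab with Equivalence.to (T-∨ {a}) ab
...   | inj₁ here  = inj₁ (Equivalence.to T-≡ here)
...   | inj₂ below = inj₂ (inj₁ (Equivalence.to T-≡ below))
covered-sound p (a ∷ x) (b ∷ y) (suc i) h with covered-sound a x y i h
... | inj₁ here                   = inj₁ here
... | inj₂ (inj₁ below)           = inj₂ (inj₁ below)
... | inj₂ (inj₂ (j , j~i , x≡)) = inj₂ (inj₂ (suc j , j~i , x≡))

covered-self : ∀ {n} p (x y : Vec Bool n) i → lookup x i ≡ true → T (covered p x y i)
covered-self p (a ∷ x) (b ∷ y) zero    refl = T-∨ˡ (head? x) (T-∨ʳ p tt)
covered-self p (a ∷ x) (b ∷ y) (suc i) x≡   = covered-self a x y i x≡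

covered-other : ∀ {n} p (x y : Vec Bool n) i → lookup y i ≡ true → T (covered p x y i)
covered-other p (a ∷ x) (b ∷ y) zero    refl = T-∨ˡ (head? x) (T-∨ʳ p (T-∨ʳ a tt))
covered-other p (a ∷ x) (b ∷ y) (suc i) y≡   = covered-other a x y i y≡

covered-neighbour : ∀ {n} p (x y : Vec Bool n) i → RowNeighbour (p ∷ x) (suc i) → T (covered p x y i)
covered-neighbour p (a ∷ x)     (b ∷ y) zero    (zero , _ , refl)                   = T-∨ˡ (head? x) tt
covered-neighbour p (a ∷ x)     (b ∷ y) zero    (suc zero , () , _)
covered-neighbour p (a ∷ c ∷ x) (b ∷ y) zero    (suc (suc zero) , _ , refl)         = T-∨ʳ (p ∨ a ∨ b) tt
covered-neighbour p (a ∷ x)     (b ∷ y) zero    (suc (suc (suc j)) , () , _)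
covered-neighbour p (a ∷ x)     (b ∷ y) (suc i) (zero , () , _)
covered-neighbour p (a ∷ x)     (b ∷ y) (suc i) (suc j , j~i , x≡)                  = covered-neighbour a x y i (j , j~i , x≡)

other : Fin 2 → Fin 2
other zero       = suc zero
other (suc zero) = zero

adjCell : ∀ {n} → Fin 2 × Fin n → Fin 2 × Fin n → Bool
adjCell (a , i) (c , j) = (eqF a c ∧ pathAdj i j) ∨ (eqF i j ∧ pathAdj a c)

eqF-refl : ∀ {k} (i : Fin k) → eqF i i ≡ true
eqF-refl zero    = refl
eqF-refl (suc i) = eqF-refl i

eqF⇒≡ : ∀ {k} (i j : Fin k) → T (eqF i j) → i ≡ j
eqF⇒≡ zero    zero    _  = refl
eqF⇒≡ (suc i) (suc j) eq = cong suc (eqF⇒≡ i j eq)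

path-part : ∀ p q → T (p ∨ (q ∧ false)) → T p
path-part p q = subst T (trans (cong (p ∨_) (∧-zeroʳ q)) (∨-identityʳ p))

adjCell-cases : ∀ {n} c (j : Fin n) a i → T (adjCell (c , j) (a , i)) →
  (c ≡ a × T (pathAdj j i)) ⊎ (c ≡ other a × j ≡ i)
adjCell-cases zero       j zero       i h = inj₁ (refl , path-part (pathAdj j i) (eqF j i) h)
adjCell-cases (suc zero) j (suc zero) i h = inj₁ (refl , path-part (pathAdj j i) (eqF j i) h)
adjCell-cases zero       j (suc zero) i h = inj₂ (refl , eqF⇒≡ j i (subst T (∧-identityʳ (eqF j i)) h))
adjCell-cases (suc zero) j zero       i h = inj₂ (refl , eqF⇒≡ j i (subst T (∧-identityʳ (eqF j i)) h))

adjCell-row : ∀ {n} a (j i : Fin n) → T (pathAdj j i) → T (adjCell (a , j) (a , i))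
adjCell-row zero       j i j~i = T-∨ˡ _ j~i
adjCell-row (suc zero) j i j~i = T-∨ˡ _ j~i

adjCell-column : ∀ {n} a (i : Fin n) → T (adjCell (other a , i) (a , i))
adjCell-column zero       i = subst (λ b → T (b ∧ true)) (sym (eqF-refl i)) tt
adjCell-column (suc zero) i = subst (λ b → T (b ∧ true)) (sym (eqF-refl i)) tt

module Grid (n : ℕ) (x y : Vec Bool n) where

  D : Subset (2 * n)
  D = x ++ (y ++ [])

  row : Fin 2 → Vec Bool n
  row zero       = x
  row (suc zero) = y

  cell : Fin 2 → Fin n → Bool
  cell a i = lookup (row a) i

  lookup-D : ∀ a i → lookup D (combine a i) ≡ cell a i
  lookup-D zero       i = lookup-++ˡ x (y ++ []) i
  lookup-D (suc zero) i = trans (lookup-++ʳ x (y ++ []) (combine {1} {n} zero i)) (lookup-++ˡ y [] i)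

  ∈D⇒cell : ∀ a i → combine a i ∈ D → cell a i ≡ true
  ∈D⇒cell a i a,i∈D = trans (sym (lookup-D a i)) ([]=⇒lookup a,i∈D)

  cell⇒∈D : ∀ a i → cell a i ≡ true → combine a i ∈ D
  cell⇒∈D a i cell≡ = lookup⇒[]= (combine a i) D (trans (lookup-D a i) cell≡)

  Covered : Fin 2 → Fin n → Set
  Covered a i = cell a i ≡ true ⊎ Σ (Fin 2) λ c → Σ (Fin n) λ j → cell c j ≡ true × T (adjCell (c , j) (a , i))

  covered⇒Covered : ∀ a i → T (covered false (row a) (row (other a)) i) → Covered a i
  covered⇒Covered a i h with covered-sound false (row a) (row (other a)) i h
  ... | inj₁ here                          = inj₁ here
  ... | inj₂ (inj₁ partner)                = inj₂ (other a , i , partner , adjCell-column a i)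
  ... | inj₂ (inj₂ (zero , _ , ()))
  ... | inj₂ (inj₂ (suc j , j~i , row≡))   = inj₂ (a , j , row≡ , adjCell-row a j i j~i)

  Covered⇒covered : ∀ a i → Covered a i → T (covered false (row a) (row (other a)) i)
  Covered⇒covered a i (inj₁ here) = covered-self false (row a) (row (other a)) i here
  Covered⇒covered a i (inj₂ (c , j , cell≡ , c~a)) with adjCell-cases c j a i c~a
  ... | inj₁ (refl , j~i) = covered-neighbour false (row a) (row (other a)) i (suc j , j~i , cell≡)
  ... | inj₂ (refl , refl) = covered-other false (row a) (row (other a)) i cell≡

  dominating⇒covered : Dominating (P2□P n) D → ∀ a i → Covered a i
  dominating⇒covered dom a i with cell a i in cell≡
  ... | true  = inj₁ refl
  ... | false with dom (combine a i) (λ a,i∈D → subst T (trans (sym (∈D⇒cell a i a,i∈D)) cell≡) tt)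
  ...   | u , u∈D , u~a,i = inj₂
    (proj₁ (remQuot n u) , proj₂ (remQuot n u) ,
     ∈D⇒cell (proj₁ (remQuot n u)) (proj₂ (remQuot n u)) (subst (_∈ D) (sym (combine-remQuot {2} n u)) u∈D) ,
     subst (λ q → T (adjCell (remQuot n u) q)) (remQuot-combine {2} {n} a i) u~a,i)

  covered⇒dominating : (∀ a i → Covered a i) → Dominating (P2□P n) D
  covered⇒dominating cov v v∉D with cov (proj₁ (remQuot n v)) (proj₂ (remQuot n v))
  ... | inj₁ here = ⊥-elim (v∉D (subst (_∈ D) (combine-remQuot {2} n v) (cell⇒∈D (proj₁ (remQuot n v)) (proj₂ (remQuot n v)) here)))
  ... | inj₂ (c , j , cell≡ , c~v) =
    combine c j , cell⇒∈D c j cell≡ ,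
    subst (λ p → T (adjCell p (remQuot n v))) (sym (remQuot-combine {2} {n} c j)) c~v

  dominating⇔allCovered : Dominating (P2□P n) D ⇔ T (allCovered false false x y)
  dominating⇔allCovered = mk⇔
    (λ dom → Equivalence.from (allCovered⇔ false false x y) λ i →
       Covered⇒covered zero i (dominating⇒covered dom zero i) ,
       Covered⇒covered (suc zero) i (dominating⇒covered dom (suc zero) i))
    (λ h → covered⇒dominating λ where
       zero       i → covered⇒Covered zero i (proj₁ (Equivalence.to (allCovered⇔ false false x y) h i))
       (suc zero) i → covered⇒Covered (suc zero) i (proj₂ (Equivalence.to (allCovered⇔ false false x y) h i)))

dominating⇔accepts : ∀ n (x y : Vec Bool n) → Dominating (P2□P n) (x ++ (y ++ [])) ⇔ T (accepts start x y)
dominating⇔accepts n x y =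
  subst (λ b → Dominating (P2□P n) (x ++ (y ++ [])) ⇔ T b)
        (sym (accepts-allCovered false false true true x y))
        (Grid.dominating⇔allCovered n x y)

-- Summary of a family of weighted objects: none, or the minimum weight with data c about
-- the objects attaining it (their number, or a symbolic expression for it).
data MinCount (C : Set) : Set where
  none : MinCount C
  best : ℕ → C → MinCount C

raise : {C : Set} → ℕ → MinCount C → MinCount C
raise w none       = none
raise w (best m c) = best (w + m) c

mapMin : {C D : Set} → (C → D) → MinCount C → MinCount D
mapMin h none       = none
mapMin h (best m c) = best m (h c)

AtLeast : {C : Set} → ℕ → MinCount C → Set
AtLeast M none       = ⊤
AtLeast M (best m _) = M ≤ m

atLeast-raise1 : {C : Set} {M : ℕ} (v : MinCount C) → AtLeast (suc M) (raise 1 v) → AtLeast M v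
atLeast-raise1 none       _         = tt
atLeast-raise1 (best m c) (s≤s M≤m) = M≤m

atLeast-raise : {C : Set} {M : ℕ} (w : ℕ) (v : MinCount C) → AtLeast (w + M) (raise w v) → AtLeast M v
atLeast-raise w none       _ = tt
atLeast-raise w (best m c) h = +-cancelˡ-≤ w _ _ h

module Transfer {C : Set} (_⊕_ : C → C → C) where

  mergeBest : ℕ → C → ℕ → C → MinCount C
  mergeBest zero    c zero     c′ = best 0 (c ⊕ c′)
  mergeBest zero    c (suc _)  _  = best 0 c
  mergeBest (suc _) _ zero     c′ = best 0 c′
  mergeBest (suc m) c (suc m′) c′ = raise 1 (mergeBest m c m′ c′)

  merge : MinCount C → MinCount C → MinCount C
  merge none       v            = v
  merge (best m c) none         = best m c
  merge (best m c) (best m′ c′) = mergeBest m c m′ c′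

  extend : (Scan → MinCount C) → Scan → Bool → Bool → MinCount C
  extend f s a b = if admits s a b then raise (𝟙 a + 𝟙 b) (f (after s a b)) else none

  step : (Scan → MinCount C) → Scan → MinCount C
  step f s = merge (merge (extend f s true true) (extend f s true false))
                   (merge (extend f s false true) (extend f s false false))

  step-cong : ∀ {f g : Scan → MinCount C} → (∀ t → f t ≡ g t) → ∀ s → step f s ≡ step g s
  step-cong {f} {g} f≗g s =
    cong₂ merge (cong₂ merge (ext true true) (ext true false)) (cong₂ merge (ext false true) (ext false false))
    where
    ext : ∀ a b → extend f s a b ≡ extend g s a b
    ext a b = cong (λ v → if admits s a b then raise (𝟙 a + 𝟙 b) v else none) (f≗g (after s a b))

  mergeBest-atLeast : ∀ {M} m c m′ c′ → AtLeast M (mergeBest m c m′ c′) → M ≤ m × M ≤ m′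
  mergeBest-atLeast {zero}  m       c m′       c′ _ = z≤n , z≤n
  mergeBest-atLeast {suc M} zero    c zero     c′ ()
  mergeBest-atLeast {suc M} zero    c (suc m′) c′ ()
  mergeBest-atLeast {suc M} (suc m) c zero     c′ ()
  mergeBest-atLeast {suc M} (suc m) c (suc m′) c′ h =
    Product.map s≤s s≤s (mergeBest-atLeast m c m′ c′ (atLeast-raise1 (mergeBest m c m′ c′) h))

  merge-atLeast : ∀ {M} v v′ → AtLeast M (merge v v′) → AtLeast M v × AtLeast M v′
  merge-atLeast none       v′           h = tt , h
  merge-atLeast (best m c) none         h = h , tt
  merge-atLeast (best m c) (best m′ c′) h = mergeBest-atLeast m c m′ c′ h

module Count = Transfer {ℕ} _+_
open Count

dp : ℕ → Scan → MinCount ℕ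
dp zero    (scan _ _ td bd) = if td ∧ bd then best 0 1 else none
dp (suc n) s                = step (dp n) s

countAt : ℕ → MinCount ℕ → ℕ
countAt M none       = 0
countAt M (best m c) = if m ≡ᵇ M then c else 0

≡ᵇ-+ : ∀ w a b → (w + a ≡ᵇ w + b) ≡ (a ≡ᵇ b)
≡ᵇ-+ zero    a b = refl
≡ᵇ-+ (suc w) a b = ≡ᵇ-+ w a b

≡ᵇ-false : ∀ m n → m ≢ n → (m ≡ᵇ n) ≡ false
≡ᵇ-false m n m≢n with m ≡ᵇ n in eq
... | false = refl
... | true  = ⊥-elim (m≢n (≡ᵇ⇒≡ m n (subst T (sym eq) tt)))

countAt-self : ∀ M c → countAt M (best M c) ≡ c
countAt-self M c = cong (λ b → if b then c else 0) (Equivalence.to T-≡ (≡⇒≡ᵇ M M refl))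

countAt-raise : ∀ w M v → countAt (w + M) (raise w v) ≡ countAt M v
countAt-raise w M none       = refl
countAt-raise w M (best m c) = cong (λ b → if b then c else 0) (≡ᵇ-+ w m M)

countAt-raise-below : ∀ {w M} v → M < w → countAt M (raise w v) ≡ 0
countAt-raise-below {w} {M} none       M<w = refl
countAt-raise-below {w} {M} (best m c) M<w =
  cong (λ b → if b then c else 0) (≡ᵇ-false (w + m) M (>⇒≢ (<-≤-trans M<w (m≤m+n w m))))

mergeBest-countAt : ∀ M m c m′ c′ → M ≤ m → M ≤ m′ →
  countAt M (mergeBest m c m′ c′) ≡ countAt M (best m c) + countAt M (best m′ c′)
mergeBest-countAt zero    zero    c zero     c′ _ _ = refl
mergeBest-countAt zero    zero    c (suc m′) c′ _ _ = sym (+-identityʳ c)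
mergeBest-countAt zero    (suc m) c zero     c′ _ _ = refl
mergeBest-countAt zero    (suc m) c (suc m′) c′ _ _ = countAt-raise-below (mergeBest m c m′ c′) (s≤s z≤n)
mergeBest-countAt (suc M) zero    c m′       c′ () _
mergeBest-countAt (suc M) (suc m) c zero     c′ _ ()
mergeBest-countAt (suc M) (suc m) c (suc m′) c′ (s≤s M≤m) (s≤s M≤m′) =
  trans (countAt-raise 1 M (mergeBest m c m′ c′)) (mergeBest-countAt M m c m′ c′ M≤m M≤m′)

merge-countAt : ∀ M v v′ → AtLeast M (merge v v′) → countAt M (merge v v′) ≡ countAt M v + countAt M v′
merge-countAt M none       v′           _ = refl
merge-countAt M (best m c) none         _ = sym (+-identityʳ _)
merge-countAt M (best m c) (best m′ c′) h = uncurry (mergeBest-countAt M m c m′ c′) (mergeBest-atLeast m c m′ c′ h)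

Sound : ∀ n → Scan → MinCount ℕ → Set
Sound n s v = ∀ M → AtLeast M v →
  (∀ x y → T (accepts {n} s x y) → M ≤ weight x y) ×
  #pairs n (λ x y → accepts s x y ∧ (weight x y ≡ᵇ M)) ≡ countAt M v

raise-sound : ∀ n t w v → Sound n t v → ∀ M → AtLeast M (raise w v) →
  (∀ x y → T (accepts {n} t x y) → M ≤ w + weight x y) ×
  #pairs n (λ x y → accepts t x y ∧ (w + weight x y ≡ᵇ M)) ≡ countAt M (raise w v)
raise-sound n t w v sound M M≤ with M <? w
... | yes M<w = (λ x y _ → ≤-trans (<⇒≤ M<w) (m≤m+n w (weight x y))) ,
                trans (#pairs-zero n missed) (sym (countAt-raise-below v M<w))
  where
  missed : ∀ x y → (accepts t x y ∧ (w + weight x y ≡ᵇ M)) ≡ false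
  missed x y = trans (cong (accepts t x y ∧_) (≡ᵇ-false (w + weight x y) M (>⇒≢ (<-≤-trans M<w (m≤m+n w _)))))
                     (∧-zeroʳ (accepts t x y))
... | no M≮w with m≤n⇒∃[o]m+o≡n (≮⇒≥ M≮w)
...   | M′ , refl with sound M′ (atLeast-raise w v M≤)
...     | bound , count = (λ x y acc → +-monoʳ-≤ w (bound x y acc)) ,
                          trans (#pairs-cong n (λ x y → cong (accepts t x y ∧_) (≡ᵇ-+ w (weight x y) M′)))
                                (trans count (sym (countAt-raise w M′ v)))

extend-sound : ∀ n f → (∀ t → Sound n t (f t)) → ∀ s a b M → AtLeast M (extend f s a b) →
  (∀ x y → T (accepts s (a ∷ x) (b ∷ y)) → M ≤ weight (a ∷ x) (b ∷ y)) ×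
  #pairs n (λ x y → accepts s (a ∷ x) (b ∷ y) ∧ (weight (a ∷ x) (b ∷ y) ≡ᵇ M)) ≡ countAt M (extend f s a b)
extend-sound n f sound s a b M M≤ with admits s a b
... | false = (λ _ _ ()) , #pairs-zero n (λ _ _ → refl)
... | true with raise-sound n (after s a b) (𝟙 a + 𝟙 b) (f (after s a b)) (sound (after s a b)) M M≤
...   | bound , count =
  (λ x y acc → subst (M ≤_) (sym (weight-∷ a b x y)) (bound x y acc)) ,
  trans (#pairs-cong n (λ x y → cong (λ k → accepts (after s a b) x y ∧ (k ≡ᵇ M)) (weight-∷ a b x y))) count

step-sound : ∀ n f → (∀ t → Sound n t (f t)) → ∀ s → Sound (suc n) s (step f s)
step-sound n f sound s M M≤ = bound , count
  where
  E : Bool → Bool → MinCount ℕ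
  E = extend f s
  upper : AtLeast M (merge (E true true) (E true false))
  upper = proj₁ (merge-atLeast (merge (E true true) (E true false)) (merge (E false true) (E false false)) M≤)
  lower : AtLeast M (merge (E false true) (E false false))
  lower = proj₂ (merge-atLeast (merge (E true true) (E true false)) (merge (E false true) (E false false)) M≤)
  part : ∀ a b → AtLeast M (E a b)
  part true  true  = proj₁ (merge-atLeast (E true true) (E true false) upper)
  part true  false = proj₂ (merge-atLeast (E true true) (E true false) upper)
  part false true  = proj₁ (merge-atLeast (E false true) (E false false) lower)
  part false false = proj₂ (merge-atLeast (E false true) (E false false) lower)
  column : ∀ a b →
    (∀ x y → T (accepts s (a ∷ x) (b ∷ y)) → M ≤ weight (a ∷ x) (b ∷ y)) ×
    #pairs n (λ x y → accepts s (a ∷ x) (b ∷ y) ∧ (weight (a ∷ x) (b ∷ y) ≡ᵇ M)) ≡ countAt M (E a b)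
  column a b = extend-sound n f sound s a b M (part a b)
  bound : ∀ x y → T (accepts s x y) → M ≤ weight x y
  bound (a ∷ x) (b ∷ y) = proj₁ (column a b) x y
  count : #pairs (suc n) (λ x y → accepts s x y ∧ (weight x y ≡ᵇ M)) ≡ countAt M (step f s)
  count = begin
    #pairs (suc n) (λ x y → accepts s x y ∧ (weight x y ≡ᵇ M))
      ≡⟨ #pairs-suc n _ ⟩
    _ ≡⟨ cong₂ _+_ (cong₂ _+_ (proj₂ (column true true)) (proj₂ (column true false)))
                   (cong₂ _+_ (proj₂ (column false true)) (proj₂ (column false false))) ⟩
    (countAt M (E true true) + countAt M (E true false)) + (countAt M (E false true) + countAt M (E false false))
      ≡⟨ sym (cong₂ _+_ (merge-countAt M (E true true) (E true false) upper)
                        (merge-countAt M (E false true) (E false false) lower)) ⟩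
    countAt M (merge (E true true) (E true false)) + countAt M (merge (E false true) (E false false))
      ≡⟨ sym (merge-countAt M (merge (E true true) (E true false)) (merge (E false true) (E false false)) M≤) ⟩
    countAt M (step f s) ∎
    where open ≡-Reasoning

dp0-sound : ∀ s → Sound 0 s (dp 0 s)
dp0-sound (scan _ _ true  true)  zero z≤n = (λ { [] [] _ → z≤n }) , refl
dp0-sound (scan _ _ true  false) M    _   = (λ { [] [] () }) , refl
dp0-sound (scan _ _ false _)     M    _   = (λ { [] [] () }) , refl

dp-sound : ∀ n s → Sound n s (dp n s)
dp-sound zero    = dp0-sound
dp-sound (suc n) = step-sound n (dp n) (dp-sound n)

γ-set⇔optimal : ∀ n M → (∀ x y → T (accepts start x y) → M ≤ weight x y) →
  (Σ (Vec Bool n) λ x₀ → Σ (Vec Bool n) λ y₀ → T (accepts start x₀ y₀) × weight x₀ y₀ ≡ M) →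
  ∀ x y → IsGammaSet (P2□P n) (x ++ (y ++ [])) ⇔ T (accepts start x y ∧ (weight x y ≡ᵇ M))
γ-set⇔optimal n M bound (x₀ , y₀ , acc₀ , weight₀) x y = mk⇔ to from
  where
  lower : ∀ D → Dominating (P2□P n) D → M ≤ ∣ D ∣
  lower D dom with rows n D
  ... | x′ , y′ , refl =
    subst (M ≤_) (sym (∣rows∣ x′ y′)) (bound x′ y′ (Equivalence.to (dominating⇔accepts n x′ y′) dom))
  to : IsGammaSet (P2□P n) (x ++ (y ++ [])) → T (accepts start x y ∧ (weight x y ≡ᵇ M))
  to (dom , minimal) = Equivalence.from T-∧ (acc , ≡⇒≡ᵇ (weight x y) M (≤-antisym upper (bound x y acc)))
    where
    acc : T (accepts start x y)
    acc = Equivalence.to (dominating⇔accepts n x y) dom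
    upper : weight x y ≤ M
    upper = subst₂ _≤_ (∣rows∣ x y) (trans (∣rows∣ x₀ y₀) weight₀)
                   (minimal (x₀ ++ (y₀ ++ [])) (Equivalence.from (dominating⇔accepts n x₀ y₀) acc₀))
  from : T (accepts start x y ∧ (weight x y ≡ᵇ M)) → IsGammaSet (P2□P n) (x ++ (y ++ []))
  from opt with Equivalence.to (T-∧ {accepts start x y}) opt
  ... | acc , weight≡ =
    Equivalence.from (dominating⇔accepts n x y) acc ,
    λ D dom → subst (_≤ ∣ D ∣) (sym (trans (∣rows∣ x y) (≡ᵇ⇒≡ (weight x y) M weight≡))) (lower D dom)

does-≡ : {P : Set} (P? : Dec P) (b : Bool) → (P → T b) → (T b → P) → does P? ≡ b
does-≡ P? true  _  T⇒P = dec-true P? (T⇒P tt)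
does-≡ P? false P⇒T _  = dec-false P? P⇒T

τ-from-dp : ∀ n {M c} → dp n start ≡ best M c → c ≢ 0 → τ (P2□P n) ≡ c
τ-from-dp n {M} {c} dp≡ c≢0 = begin
  τ (P2□P n)
    ≡⟨ length-filter≡∑ (isGamma? (P2□P n)) (allSubsets (2 * n)) ⟩
  ∑ (allSubsets (2 * n)) (𝟙 ∘ does ∘ isGamma? (P2□P n))
    ≡⟨ count-subsets n (does ∘ isGamma? (P2□P n)) ⟩
  #pairs n (λ x y → does (isGamma? (P2□P n) (x ++ (y ++ []))))
    ≡⟨ #pairs-cong n (λ x y → does-≡ (isGamma? (P2□P n) (x ++ (y ++ []))) (optimal x y)
                                     (Equivalence.to (characterisation x y)) (Equivalence.from (characterisation x y))) ⟩
  #pairs n optimal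
    ≡⟨ trans count (countAt-self M c) ⟩
  c ∎
  where
  open ≡-Reasoning
  optimal : Vec Bool n → Vec Bool n → Bool
  optimal x y = accepts start x y ∧ (weight x y ≡ᵇ M)
  sound : Sound n start (best M c)
  sound = subst (Sound n start) dp≡ (dp-sound n start)
  bound : ∀ x y → T (accepts start x y) → M ≤ weight x y
  bound = proj₁ (sound M ≤-refl)
  count : #pairs n optimal ≡ countAt M (best M c)
  count = proj₂ (sound M ≤-refl)
  attained : Σ (Vec Bool n) λ x₀ → Σ (Vec Bool n) λ y₀ → T (accepts start x₀ y₀) × weight x₀ y₀ ≡ M
  attained with #pairs-witness n optimal (λ #≡0 → c≢0 (trans (sym (countAt-self M c)) (trans (sym count) #≡0)))
  ... | x₀ , y₀ , opt with Equivalence.to (T-∧ {accepts start x₀ y₀}) opt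
  ...   | acc , weight≡ = x₀ , y₀ , acc , ≡ᵇ⇒≡ (weight x₀ y₀) M weight≡
  characterisation : ∀ x y → IsGammaSet (P2□P n) (x ++ (y ++ [])) ⇔ T (optimal x y)
  characterisation = γ-set⇔optimal n M bound attained

Affine : Set
Affine = ℕ × ℕ

_⊕_ : Affine → Affine → Affine
(a , b) ⊕ (a′ , b′) = a + a′ , b + b′

at : ℕ → Affine → ℕ
at j (a , b) = a * j + b

at-⊕ : ∀ j u v → at j (u ⊕ v) ≡ at j u + at j v
at-⊕ j (a , b) (a′ , b′) = distrib a b a′ b′ j
  where
  distrib : ∀ a b a′ b′ j → (a + a′) * j + (b + b′) ≡ (a * j + b) + (a′ * j + b′)
  distrib = solve-∀

module Symbolic = Transfer _⊕_

eval : ℕ → MinCount Affine → MinCount ℕ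
eval j v = raise j (mapMin (at j) v)

raise-0 : {C : Set} (v : MinCount C) → raise 0 v ≡ v
raise-0 none       = refl
raise-0 (best m c) = refl

raise-raise : {C : Set} (w w′ : ℕ) (v : MinCount C) → raise w (raise w′ v) ≡ raise (w + w′) v
raise-raise w w′ none       = refl
raise-raise w w′ (best m c) = cong (λ k → best k c) (sym (+-assoc w w′ m))

raise-mapMin : {C D : Set} (h : C → D) (w : ℕ) (v : MinCount C) → raise w (mapMin h v) ≡ mapMin h (raise w v)
raise-mapMin h w none       = refl
raise-mapMin h w (best m c) = refl

mergeBest-shift : ∀ j m c m′ c′ → Count.mergeBest (j + m) c (j + m′) c′ ≡ raise j (Count.mergeBest m c m′ c′)
mergeBest-shift zero    m c m′ c′ = sym (raise-0 (Count.mergeBest m c m′ c′))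
mergeBest-shift (suc j) m c m′ c′ =
  trans (cong (raise 1) (mergeBest-shift j m c m′ c′)) (raise-raise 1 j (Count.mergeBest m c m′ c′))

mergeBest-at : ∀ j m c m′ c′ →
  Count.mergeBest m (at j c) m′ (at j c′) ≡ mapMin (at j) (Symbolic.mergeBest m c m′ c′)
mergeBest-at j zero    c zero     c′ = cong (best 0) (sym (at-⊕ j c c′))
mergeBest-at j zero    c (suc m′) c′ = refl
mergeBest-at j (suc m) c zero     c′ = refl
mergeBest-at j (suc m) c (suc m′) c′ =
  trans (cong (raise 1) (mergeBest-at j m c m′ c′)) (raise-mapMin (at j) 1 (Symbolic.mergeBest m c m′ c′))

eval-merge : ∀ j v v′ → Count.merge (eval j v) (eval j v′) ≡ eval j (Symbolic.merge v v′)
eval-merge j none       v′           = refl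
eval-merge j (best m c) none         = refl
eval-merge j (best m c) (best m′ c′) =
  trans (mergeBest-shift j m (at j c) m′ (at j c′)) (cong (raise j) (mergeBest-at j m c m′ c′))

eval-raise : ∀ j w v → raise w (eval j v) ≡ eval j (raise w v)
eval-raise j w none       = refl
eval-raise j w (best m c) = cong (λ k → best k (at j c)) (x∙yz≈y∙xz w j m)

eval-extend : ∀ j f s a b → Count.extend (eval j ∘ f) s a b ≡ eval j (Symbolic.extend f s a b)
eval-extend j f s a b with admits s a b
... | true  = eval-raise j (𝟙 a + 𝟙 b) (f (after s a b))
... | false = refl

eval-step : ∀ j f s → Count.step (eval j ∘ f) s ≡ eval j (Symbolic.step f s)
eval-step j f s = begin
  Count.merge (Count.merge (E true true) (E true false)) (Count.merge (E false true) (E false false))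
    ≡⟨ cong₂ Count.merge (cong₂ Count.merge (eval-extend j f s true true) (eval-extend j f s true false))
                         (cong₂ Count.merge (eval-extend j f s false true) (eval-extend j f s false false)) ⟩
  Count.merge (Count.merge (eval j (S true true)) (eval j (S true false)))
              (Count.merge (eval j (S false true)) (eval j (S false false)))
    ≡⟨ cong₂ Count.merge (eval-merge j (S true true) (S true false)) (eval-merge j (S false true) (S false false)) ⟩
  Count.merge (eval j (Symbolic.merge (S true true) (S true false))) (eval j (Symbolic.merge (S false true) (S false false)))
    ≡⟨ eval-merge j (Symbolic.merge (S true true) (S true false)) (Symbolic.merge (S false true) (S false false)) ⟩
  eval j (Symbolic.step f s) ∎
  where
  open ≡-Reasoning
  E : Bool → Bool → MinCount ℕ
  E = Count.extend (eval j ∘ f) s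
  S : Bool → Bool → MinCount Affine
  S = Symbolic.extend f s

-- The table dp (9 + 2j), written symbolically in j.
oddProfile : Scan → MinCount Affine
oddProfile (scan _     _     false false) = best 6 (0 , 2)
oddProfile (scan _     _     false true)  = best 5 (0 , 1)
oddProfile (scan _     _     true  false) = best 5 (0 , 1)
oddProfile (scan false false true  true)  = best 5 (0 , 2)
oddProfile (scan false true  true  true)  = best 5 (2 , 11)
oddProfile (scan true  false true  true)  = best 5 (2 , 11)
oddProfile (scan true  true  true  true)  = best 5 (4 , 22)

nextPeriod : MinCount Affine → MinCount Affine
nextPeriod none             = none
nextPeriod (best e (a , b)) = best (suc e) (a , a + b)

eval-nextPeriod : ∀ j v → eval j (nextPeriod v) ≡ eval (suc j) v
eval-nextPeriod j none             = refl
eval-nextPeriod j (best e (a , b)) = cong₂ best (+-suc j e) (shift a b j)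
  where
  shift : ∀ a b j → a * j + (a + b) ≡ a * (1 + j) + b
  shift = solve-∀

twoSteps : ∀ s → Symbolic.step (Symbolic.step oddProfile) s ≡ nextPeriod (oddProfile s)
twoSteps (scan false false false false) = refl
twoSteps (scan false false false true)  = refl
twoSteps (scan false false true  false) = refl
twoSteps (scan false false true  true)  = refl
twoSteps (scan false true  false false) = refl
twoSteps (scan false true  false true)  = refl
twoSteps (scan false true  true  false) = refl
twoSteps (scan false true  true  true)  = refl
twoSteps (scan true  false false false) = refl
twoSteps (scan true  false false true)  = refl
twoSteps (scan true  false true  false) = refl
twoSteps (scan true  false true  true)  = refl
twoSteps (scan true  true  false false) = refl
twoSteps (scan true  true  false true)  = refl
twoSteps (scan true  true  true  false) = refl
twoSteps (scan true  true  true  true)  = refl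

dp-9 : ∀ s → dp 9 s ≡ eval 0 (oddProfile s)
dp-9 (scan false false false false) = refl
dp-9 (scan false false false true)  = refl
dp-9 (scan false false true  false) = refl
dp-9 (scan false false true  true)  = refl
dp-9 (scan false true  false false) = refl
dp-9 (scan false true  false true)  = refl
dp-9 (scan false true  true  false) = refl
dp-9 (scan false true  true  true)  = refl
dp-9 (scan true  false false false) = refl
dp-9 (scan true  false false true)  = refl
dp-9 (scan true  false true  false) = refl
dp-9 (scan true  false true  true)  = refl
dp-9 (scan true  true  false false) = refl
dp-9 (scan true  true  false true)  = refl
dp-9 (scan true  true  true  false) = refl
dp-9 (scan true  true  true  true)  = refl

dp-odd : ∀ j s → dp (9 + (j + j)) s ≡ eval j (oddProfile s)
dp-odd zero    s = dp-9 s
dp-odd (suc j) s = begin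
  dp (10 + (j + suc j)) s
    ≡⟨ cong (λ k → dp (10 + k) s) (+-suc j j) ⟩
  step (step (dp (9 + (j + j)))) s
    ≡⟨ step-cong (step-cong (dp-odd j)) s ⟩
  step (step (eval j ∘ oddProfile)) s
    ≡⟨ step-cong (eval-step j oddProfile) s ⟩
  step (eval j ∘ Symbolic.step oddProfile) s
    ≡⟨ eval-step j (Symbolic.step oddProfile) s ⟩
  eval j (Symbolic.step (Symbolic.step oddProfile) s)
    ≡⟨ cong (eval j) (twoSteps s) ⟩
  eval j (nextPeriod (oddProfile s))
    ≡⟨ eval-nextPeriod j (oddProfile s) ⟩
  eval (suc j) (oddProfile s) ∎
  where open ≡-Reasoning

dp-even : ∀ j s → dp (10 + (j + j)) s ≡ eval j (Symbolic.step oddProfile s)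
dp-even j s = trans (step-cong (dp-odd j) s) (eval-step j oddProfile s)

τ-odd : ∀ j → τ (P2□P (9 + (j + j))) ≡ 2
τ-odd j = τ-from-dp (9 + (j + j)) (dp-odd j start) (λ ())

τ-even : ∀ j → τ (P2□P (10 + (j + j))) ≡ 2 * (10 + (j + j)) + 4
τ-even j = trans (τ-from-dp (10 + (j + j)) (dp-even j start) (m+1+n≢0 (4 * j))) (linear j)
  where
  linear : ∀ j → 4 * j + 24 ≡ 2 * (10 + (j + j)) + 4
  linear = solve-∀

parity : ∀ k → Σ ℕ λ j → k ≡ j + j ⊎ k ≡ suc (j + j)
parity zero = 0 , inj₁ refl
parity (suc k) with parity k
... | j , inj₁ k≡ = j , inj₂ (cong suc k≡)
... | j , inj₂ k≡ = suc j , inj₁ (trans (cong suc k≡) (cong suc (sym (+-suc j j))))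

odd-9+2j : ∀ j → ¬ (2 ∣ 9 + (j + j))
odd-9+2j j 2∣n with ∣1⇒≡1 (∣m+n∣m⇒∣n (subst (2 ∣_) (split j) 2∣n) (n∣m*n (4 + j)))
  where
  split : ∀ j → 9 + (j + j) ≡ (4 + j) * 2 + 1
  split = solve-∀
... | ()

even-10+2j : ∀ j → 2 ∣ 10 + (j + j)
even-10+2j j = divides (5 + j) (halve j)
  where
  halve : ∀ j → 10 + (j + j) ≡ (5 + j) * 2
  halve = solve-∀

2∤3 : ¬ (2 ∣ 3)
2∤3 = toWitnessFalse {a? = 2 ∣? 3} tt

TauFormula : ℕ → Set
TauFormula n =
  (n ≡ 2 → τ (P2□P n) ≡ 6) ×
  (n ≡ 3 → τ (P2□P n) ≡ 3) ×
  (n ≡ 6 → τ (P2□P n) ≡ 17) ×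
  (¬ (2 ∣ n) → n ≢ 3 → τ (P2□P n) ≡ 2) ×
  (2 ∣ n → n ≢ 2 → n ≢ 6 → τ (P2□P n) ≡ 2 * n + 4)

formula-odd : ∀ n → ¬ (2 ∣ n) → n ≢ 3 → τ (P2□P n) ≡ 2 → TauFormula n
formula-odd n odd n≢3 τ≡2 =
  (λ n≡2 → ⊥-elim (odd (subst (2 ∣_) (sym n≡2) (divides 1 refl)))) ,
  (λ n≡3 → ⊥-elim (n≢3 n≡3)) ,
  (λ n≡6 → ⊥-elim (odd (subst (2 ∣_) (sym n≡6) (divides 3 refl)))) ,
  (λ _ _ → τ≡2) ,
  (λ even → ⊥-elim (odd even))

formula-even : ∀ n → 2 ∣ n → n ≢ 2 → n ≢ 6 → τ (P2□P n) ≡ 2 * n + 4 → TauFormula n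
formula-even n even n≢2 n≢6 τ≡ =
  (λ n≡2 → ⊥-elim (n≢2 n≡2)) ,
  (λ n≡3 → ⊥-elim (2∤3 (subst (2 ∣_) n≡3 even))) ,
  (λ n≡6 → ⊥-elim (n≢6 n≡6)) ,
  (λ odd _ → ⊥-elim (odd even)) ,
  (λ _ _ _ → τ≡)

-- The case analyses below produce this form,
-- so that the type checker only compares numerals: comparing τ (P2□P m) with τ (P2□P n)
-- for syntactically different but equal m and n would make it evaluate τ.
TauFormulaAt : ℕ → Set
TauFormulaAt n = Σ ℕ λ m → m ≡ n × TauFormula m

-- Beyond 9 the theorem follows from the periodic values according to parity.  (The case
-- split is on an argument rather than by `with`, which would normalise τ in the goal.)
from-nine : ∀ k → (Σ ℕ λ j → k ≡ j + j ⊎ k ≡ suc (j + j)) → TauFormulaAt (9 + k)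
from-nine _ (j , inj₁ refl) = 9 + (j + j) , refl , formula-odd (9 + (j + j)) (odd-9+2j j) (λ ()) (τ-odd j)
from-nine _ (j , inj₂ refl) = 10 + (j + j) , refl , formula-even (10 + (j + j)) (even-10+2j j) (λ ()) (λ ()) (τ-even j)

tauFormula : ∀ n → 2 ≤ n → TauFormulaAt n
tauFormula 1 (s≤s ())
tauFormula 2 _ = 2 , refl , (λ _ → τ-from-dp 2 refl (λ ())) , (λ ()) , (λ ()) ,
                            (λ odd _ → ⊥-elim (odd (divides 1 refl))) , (λ _ 2≢2 → ⊥-elim (2≢2 refl))
tauFormula 3 _ = 3 , refl , (λ ()) , (λ _ → τ-from-dp 3 refl (λ ())) , (λ ()) ,
                            (λ _ 3≢3 → ⊥-elim (3≢3 refl)) , (λ even → ⊥-elim (2∤3 even))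
tauFormula 4 _ = 4 , refl , formula-even 4 (divides 2 refl) (λ ()) (λ ()) (τ-from-dp 4 refl (λ ()))
tauFormula 5 _ = 5 , refl , formula-odd 5 (toWitnessFalse {a? = 2 ∣? 5} tt) (λ ()) (τ-from-dp 5 refl (λ ()))
tauFormula 6 _ = 6 , refl , (λ ()) , (λ ()) , (λ _ → τ-from-dp 6 refl (λ ())) ,
                            (λ odd _ → ⊥-elim (odd (divides 3 refl))) , (λ _ _ 6≢6 → ⊥-elim (6≢6 refl))
tauFormula 7 _ = 7 , refl , formula-odd 7 (toWitnessFalse {a? = 2 ∣? 7} tt) (λ ()) (τ-from-dp 7 refl (λ ()))
tauFormula 8 _ = 8 , refl , formula-even 8 (divides 4 refl) (λ ()) (λ ()) (τ-from-dp 8 refl (λ ()))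
tauFormula (suc (suc (suc (suc (suc (suc (suc (suc (suc k))))))))) _ = from-nine k (parity k)

theorem3p4 : (n : ℕ) → 2 ≤ n →
    (n ≡ 2 → τ (P2□P n) ≡ 6) ×
    (n ≡ 3 → τ (P2□P n) ≡ 3) ×
    (n ≡ 6 → τ (P2□P n) ≡ 17) ×
    (¬ (2 ∣ n) → n ≢ 3 → τ (P2□P n) ≡ 2) ×
    (2 ∣ n → n ≢ 2 → n ≢ 6 → τ (P2□P n) ≡ 2 * n + 4)
theorem3p4 n 2≤n = let (m , m≡n , formula) = tauFormula n 2≤n in subst TauFormula m≡n formula
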